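{- For $n\ge 4$, $\mathrm{pthin}_{prec}(CR_n)=n+1$, while $\mathrm{pthin}_{prec}(CR_1)=\mathrm{pthin}_{prec}(CR_2)=1$ and $\mathrm{pthin}_{prec}(CR_3)=3$.
   Context: The crown graph $CR_n$ is obtained from $K_{n,n}$ by removing a perfect matching. An ordering $<$ of $V(G)$ is consistent with a partition $\mathcal{V}$ if for every $p<q<r$ with $p,q$ in the same class and $pr\in E(G)$, also $qr\in E(G)$; it is strongly consistent if both $<$ and its reversal are consistent. The precedence proper thinness $\mathrm{pthin}_{prec}(G)$ is the minimum $k$ such that there exist a partition of $V(G)$ into $k$ classes and an ordering strongly consistent with it in which the vertices of each class are consecutive. -}

module Defs where

open import Data.Nat using (ℕ; _+_; _≤_)
open import Data.Fin using (Fin; splitAt) renaming (_<_ to _<ᶠ_)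
open import Data.Fin.Permutation using (Permutation′; _⟨$⟩ʳ_)
open import Data.Sum using (_⊎_; inj₁; inj₂)
open import Data.Product using (Σ; _×_; ∃)
open import Data.Empty using (⊥)
open import Relation.Binary.PropositionalEquality using (_≡_)
open import Relation.Nullary using (¬_)
open import Function using (Surjective)

record Graph : Set₁ where
  field
    N    : ℕ
    Adj  : Fin N → Fin N → Set
    sym  : ∀ {u v} → Adj u v → Adj v u
    irr  : ∀ {u} → ¬ Adj u u
open Graph public

-- Crown graph CR_n: vertices Fin (n + n); the first n are a_0..a_{n-1},
-- the last n are b_0..b_{n-1}; a_i ~ b_j iff i ≠ j (K_{n,n} minus a perfect matching).
CrAdj : (n : ℕ) → Fin n ⊎ Fin n → Fin n ⊎ Fin n → Set
CrAdj n (inj₁ i) (inj₂ j) = ¬ (i ≡ j)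
CrAdj n (inj₂ i) (inj₁ j) = ¬ (i ≡ j)
CrAdj n (inj₁ _) (inj₁ _) = ⊥
CrAdj n (inj₂ _) (inj₂ _) = ⊥

crSym : ∀ n {x y} → CrAdj n x y → CrAdj n y x
crSym n {inj₁ i} {inj₂ j} p = λ e → p (Relation.Binary.PropositionalEquality.sym e)
crSym n {inj₂ i} {inj₁ j} p = λ e → p (Relation.Binary.PropositionalEquality.sym e)

crIrr : ∀ n {x} → ¬ CrAdj n x x
crIrr n {inj₁ i} ()
crIrr n {inj₂ i} ()

CR : ℕ → Graph
CR n = record
  { N   = n + n
  ; Adj = λ u v → CrAdj n (splitAt n u) (splitAt n v)
  ; sym = crSym n
  ; irr = crIrr n
  }

-- A vertex ordering is given by a permutation π : position of v is π ⟨$⟩ʳ v;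
-- u < v iff π u < π v.  A partition into k classes is a surjective
-- class map c : V → Fin k (so all k classes are nonempty).
module _ (G : Graph) where

  _≺[_]_ : Fin (N G) → Permutation′ (N G) → Fin (N G) → Set
  u ≺[ π ] v = (π ⟨$⟩ʳ u) <ᶠ (π ⟨$⟩ʳ v)

  Consistent : ∀ {k} → (Fin (N G) → Fin k) → Permutation′ (N G) → Set
  Consistent c π = ∀ p q r → p ≺[ π ] q → q ≺[ π ] r →
    c p ≡ c q → Adj G p r → Adj G q r

  -- the reversal of π is consistent with c
  RevConsistent : ∀ {k} → (Fin (N G) → Fin k) → Permutation′ (N G) → Set
  RevConsistent c π = ∀ p q r → q ≺[ π ] p → r ≺[ π ] q →
    c p ≡ c q → Adj G p r → Adj G q r

  StronglyConsistent : ∀ {k} → (Fin (N G) → Fin k) → Permutation′ (N G) → Set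
  StronglyConsistent c π = Consistent c π × RevConsistent c π

  ClassesConsecutive : ∀ {k} → (Fin (N G) → Fin k) → Permutation′ (N G) → Set
  ClassesConsecutive c π = ∀ p q r → p ≺[ π ] q → q ≺[ π ] r →
    c p ≡ c r → c q ≡ c p

  PrecThin : ℕ → Set
  PrecThin k = Σ (Fin (N G) → Fin k) λ c → Surjective _≡_ _≡_ c ×
    ∃ λ π → StronglyConsistent c π × ClassesConsecutive c π

  PthinPrecIs : ℕ → Set
  PthinPrecIs k = PrecThin k × (∀ k′ → PrecThin k′ → k ≤ k′)

-- Call the vertex y at some position a link end if the vertex x just before it lies in
-- the same class. For such x and y, strong consistency says that every other vertex adjacent to x but
-- not to y precedes x, and every other vertex adjacent to y but not to x follows y. In the crown this
-- forces distinct link ends to have distinct indices once n ≥ 3; for n ≥ 4 it moreover rules out that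
-- the indices of both the first and the last vertex are indices of link ends. Every other position
-- starts a class, and different positions of this kind start different classes. Hence 2n ≤ n + k,
-- and 2n ≤ (n - 1) + k when n ≥ 4.
--
-- For n = m + 1 let T_i be a_i for even i and b_i for odd i, and F_i the other vertex
-- of index i. The order T_0 | T_1 F_0 | T_2 F_1 | ... | T_m F_(m-1) | F_m, whose bars separate
-- n + 1 classes, is strongly consistent: T_j and F_(j-1) lie on the same side, and the only vertices
-- adjacent to exactly one of them are T_(j-1), placed before the pair, and F_j, placed after it.
--
-- The small crowns are settled by deciding the definitions on explicit orderings.

module Submission where

open import Defs hiding (sym)
open import Data.Bool using (Bool; true; false; not; if_then_else_)
open import Data.Bool.Properties using (not-involutive; not-¬)
open import Data.Nat using (ℕ; zero; suc; _≤_; _<_; _+_; z≤n; s≤s; s≤s⁻¹)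
import Data.Nat as ℕ
open import Data.Nat.Properties
  using (≤-refl; ≤-reflexive; ≤-trans; ≤-antisym; <⇒≤; <-trans; <-irrefl; <-asym; <-cmp; <⇒≢; <⇒≱;
         ≤∧≢⇒<; m<1+n⇒m≤n; m<1+n⇒m<n∨m≡n; n≤1+n; n<1+n; 1+n≰n; m≤m+n; suc-injective;
         +-comm; +-suc; +-mono-≤; +-cancelˡ-≤; module ≤-Reasoning)
open import Data.Fin using (Fin; zero; suc; toℕ; fromℕ; fromℕ<; inject₁; join; splitAt; punchOut; _<?_)
  renaming (_≟_ to _≟ᶠ_)
open import Data.Fin.Patterns using (0F; 1F; 2F; 3F; 4F; 5F)
open import Data.Fin.Properties
  using (toℕ-injective; toℕ-inject₁; toℕ<n; toℕ-fromℕ<; ≤fromℕ; injective⇒≤; splitAt-join; join-splitAt;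
         punchOut-injective; ¬∀⟶∃¬; all?; any?)
open import Data.Fin.Permutation
  using (Permutation′; _⟨$⟩ʳ_; _⟨$⟩ˡ_; inverseˡ; inverseʳ; permutation; transpose)
import Data.Fin.Permutation as Permutation
open import Data.List using (List; []; _∷_; length; lookup)
open import Data.List.Membership.Propositional using (_∈_; _∉_)
open import Data.List.Relation.Unary.Any using (here; there; index)
import Data.List.Relation.Unary.Any as Any
open import Data.List.Relation.Unary.Any.Properties using (lookup-index)
import Data.Vec.Functional as Vector
open import Data.Sum using (_⊎_; inj₁; inj₂; swap)
open import Data.Sum.Properties using (inj₁-injective; inj₂-injective; swap-involutive; ≡-dec)
open import Data.Product using (_×_; _,_; ∃; ∃₂; proj₁; proj₂)
open import Data.Empty using (⊥; ⊥-elim)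
open import Function using (_∘_; id; case_of_; Injective)
open import Function.Consequences.Propositional using (strictlySurjective⇒surjective)
open import Relation.Binary using (tri<; tri≈; tri>)
open import Relation.Binary.PropositionalEquality
  using (_≡_; _≢_; refl; sym; trans; cong; cong₂; subst; subst₂; module ≡-Reasoning)
open import Relation.Nullary using (Dec; yes; no; ¬_; ¬?)
open import Relation.Nullary.Decidable using (True; toWitness; _×-dec_; _→-dec_)

∃∉ : ∀ {n} (xs : List (Fin n)) → length xs < n → ∃ λ i → i ∉ xs
∃∉ {n} xs len<n = ¬∀⟶∃¬ n (_∈ xs) (λ i → Any.any? (i ≟ᶠ_) xs) all∈
  where
  all∈ : ¬ (∀ i → i ∈ xs)
  all∈ ∈xs = <⇒≱ len<n (injective⇒≤ {f = λ i → index (∈xs i)} λ {i} {j} eq →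
    trans (lookup-index (∈xs i)) (trans (cong (lookup xs) eq) (sym (lookup-index (∈xs j)))))

fresh₂ : ∀ {n} → 3 ≤ n → (i j : Fin n) → ∃ λ m → m ≢ i × m ≢ j
fresh₂ 3≤n i j with ∃∉ (i ∷ j ∷ []) 3≤n
... | m , m∉ = m , m∉ ∘ here , m∉ ∘ there ∘ here

fresh₃ : ∀ {n} → 4 ≤ n → (i j l : Fin n) → ∃ λ m → m ≢ i × m ≢ j × m ≢ l
fresh₃ 4≤n i j l with ∃∉ (i ∷ j ∷ l ∷ []) 4≤n
... | m , m∉ = m , m∉ ∘ here , m∉ ∘ there ∘ here , m∉ ∘ there ∘ there ∘ here

-- Consecutive vertices of a class in the crown

V : ℕ → Set
V n = Fin n ⊎ Fin n

idx : ∀ {n} → V n → Fin n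
idx (inj₁ i) = i
idx (inj₂ i) = i

module Links {n : ℕ} (pos : V n → ℕ) (pos-injective : ∀ {u v} → pos u ≡ pos v → u ≡ v) where

  -- The conditions that strong consistency imposes on consecutive vertices x, y of one class.
  record Link (x y : V n) : Set where
    field
      next     : pos y ≡ suc (pos x)
      forward  : ∀ r → pos y < pos r → CrAdj n x r → CrAdj n y r
      backward : ∀ r → pos r < pos x → CrAdj n y r → CrAdj n x r

  open Link

  First Last : V n → Set
  First f = ∀ w → pos f ≤ pos w
  Last z = ∀ w → pos w ≤ pos z

  Link⇒< : ∀ {x y} → Link x y → pos x < pos y
  Link⇒< {x} L = subst (pos x <_) (sym (next L)) ≤-refl

  Link-functional : ∀ {x y y'} → Link x y → Link x y' → y ≡ y'
  Link-functional L L' = pos-injective (trans (next L) (sym (next L')))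

  private-before : ∀ {x y r} → Link x y → r ≢ y → CrAdj n x r → ¬ CrAdj n y r → pos r < pos x
  private-before {x} {y} {r} L r≢y xr ¬yr with <-cmp (pos r) (pos x)
  ... | tri< r<x _ _ = r<x
  ... | tri≈ _ r≡x _ = ⊥-elim (crIrr n (subst (CrAdj n x) (pos-injective r≡x) xr))
  ... | tri> _ _ x<r = ⊥-elim (¬yr (forward L r y<r xr))
    where
    y<r : pos y < pos r
    y<r = ≤∧≢⇒< (subst (_≤ pos r) (sym (next L)) x<r) (λ e → r≢y (pos-injective (sym e)))

  private-after : ∀ {x y r} → Link x y → r ≢ x → CrAdj n y r → ¬ CrAdj n x r → pos y < pos r
  private-after {x} {y} {r} L r≢x yr ¬xr with <-cmp (pos y) (pos r)
  ... | tri< y<r _ _ = y<r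
  ... | tri≈ _ y≡r _ = ⊥-elim (crIrr n (subst (CrAdj n y) (sym (pos-injective y≡r)) yr))
  ... | tri> _ _ r<y = ⊥-elim (¬xr (backward L r r<x yr))
    where
    r<x : pos r < pos x
    r<x = ≤∧≢⇒< (m<1+n⇒m≤n (subst (pos r <_) (next L) r<y)) (λ e → r≢x (pos-injective e))

  aa-distinct : ∀ {i j} → Link (inj₁ i) (inj₁ j) → i ≢ j
  aa-distinct L refl = <-irrefl refl (Link⇒< L)

  bb-distinct : ∀ {i j} → Link (inj₂ i) (inj₂ j) → i ≢ j
  bb-distinct L refl = <-irrefl refl (Link⇒< L)

  aa-before : ∀ {i j} → Link (inj₁ i) (inj₁ j) → pos (inj₂ j) < pos (inj₁ i)
  aa-before L = private-before L (λ ()) (aa-distinct L) (λ j≢j → j≢j refl)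

  aa-after : ∀ {i j} → Link (inj₁ i) (inj₁ j) → pos (inj₁ j) < pos (inj₂ i)
  aa-after L = private-after L (λ ()) (aa-distinct L ∘ sym) (λ i≢i → i≢i refl)

  bb-before : ∀ {i j} → Link (inj₂ i) (inj₂ j) → pos (inj₁ j) < pos (inj₂ i)
  bb-before L = private-before L (λ ()) (bb-distinct L) (λ j≢j → j≢j refl)

  bb-after : ∀ {i j} → Link (inj₂ i) (inj₂ j) → pos (inj₂ j) < pos (inj₁ i)
  bb-after L = private-after L (λ ()) (bb-distinct L ∘ sym) (λ i≢i → i≢i refl)

  ab-before : ∀ {i j m} → Link (inj₁ i) (inj₂ j) → m ≢ i → m ≢ j → pos (inj₂ m) < pos (inj₁ i)
  ab-before L m≢i m≢j = private-before L (m≢j ∘ inj₂-injective) (m≢i ∘ sym) (λ ())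

  ab-after : ∀ {i j m} → Link (inj₁ i) (inj₂ j) → m ≢ i → m ≢ j → pos (inj₂ j) < pos (inj₁ m)
  ab-after L m≢i m≢j = private-after L (m≢i ∘ inj₁-injective) (m≢j ∘ sym) (λ ())

  ba-before : ∀ {i j m} → Link (inj₂ i) (inj₁ j) → m ≢ i → m ≢ j → pos (inj₁ m) < pos (inj₂ i)
  ba-before L m≢i m≢j = private-before L (m≢j ∘ inj₁-injective) (m≢i ∘ sym) (λ ())

  ba-after : ∀ {i j m} → Link (inj₂ i) (inj₁ j) → m ≢ i → m ≢ j → pos (inj₁ j) < pos (inj₂ m)
  ba-after L m≢i m≢j = private-after L (m≢i ∘ inj₂-injective) (m≢j ∘ sym) (λ ())

  start-not-first : 3 ≤ n → ∀ {x y} → Link x y → ¬ First x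
  start-not-first _ {inj₁ _} {inj₁ _} L F = <⇒≱ (aa-before L) (F _)
  start-not-first _ {inj₂ _} {inj₂ _} L F = <⇒≱ (bb-before L) (F _)
  start-not-first 3≤n {inj₁ i} {inj₂ j} L F =
    let (m , m≢i , m≢j) = fresh₂ 3≤n i j in <⇒≱ (ab-before L m≢i m≢j) (F _)
  start-not-first 3≤n {inj₂ i} {inj₁ j} L F =
    let (m , m≢i , m≢j) = fresh₂ 3≤n i j in <⇒≱ (ba-before L m≢i m≢j) (F _)

  end-not-last : 3 ≤ n → ∀ {x y} → Link x y → ¬ Last y
  end-not-last _ {inj₁ _} {inj₁ _} L Z = <⇒≱ (aa-after L) (Z _)
  end-not-last _ {inj₂ _} {inj₂ _} L Z = <⇒≱ (bb-after L) (Z _)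
  end-not-last 3≤n {inj₁ i} {inj₂ j} L Z =
    let (m , m≢i , m≢j) = fresh₂ 3≤n i j in <⇒≱ (ab-after L m≢i m≢j) (Z _)
  end-not-last 3≤n {inj₂ i} {inj₁ j} L Z =
    let (m , m≢i , m≢j) = fresh₂ 3≤n i j in <⇒≱ (ba-after L m≢i m≢j) (Z _)

  six-cycle : ∀ {i j k m} → Link (inj₂ i) (inj₁ j) → Link (inj₁ k) (inj₂ j) →
              m ≢ i → m ≢ j → m ≢ k → ⊥
  six-cycle L L' m≢i m≢j m≢k = <-asym (ab-after L' m≢k m≢j)
    (<-trans (ba-before L m≢i m≢j) (<-trans (Link⇒< L)
      (<-trans (ba-after L m≢i m≢j) (<-trans (ab-before L' m≢k m≢j) (Link⇒< L')))))

  ¬crossed-links : 3 ≤ n → ∀ {x x' j} → Link x (inj₁ j) → Link x' (inj₂ j) → ⊥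
  ¬crossed-links _ {inj₁ i} {inj₂ k} L L' =
    <-asym (aa-before L) (<-trans (Link⇒< L) (<-trans (bb-before L') (Link⇒< L')))
  ¬crossed-links _ {inj₁ i} {inj₁ k} L L' with i ≟ᶠ k
  ... | yes refl = case Link-functional L L' of λ ()
  ... | no i≢k = <-asym (ab-before L' i≢k (aa-distinct L))
    (<-trans (Link⇒< L') (<-trans (aa-before L) (<-trans (Link⇒< L) (aa-after L))))
  ¬crossed-links _ {inj₂ i} {inj₂ k} L L' with k ≟ᶠ i
  ... | yes refl = case Link-functional L L' of λ ()
  ... | no k≢i = <-asym (ba-before L k≢i (bb-distinct L'))
    (<-trans (Link⇒< L) (<-trans (bb-before L') (<-trans (Link⇒< L') (bb-after L'))))
  ¬crossed-links 3≤n {inj₂ i} {inj₁ k} {j} L L' with k ≟ᶠ i | k ≟ᶠ j | i ≟ᶠ j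
  ... | yes refl | _ | _ = let (m , m≢i , m≢j) = fresh₂ 3≤n i j in six-cycle L L' m≢i m≢j m≢i
  ... | no _ | yes refl | _ = let (m , m≢i , m≢j) = fresh₂ 3≤n i j in six-cycle L L' m≢i m≢j m≢j
  ... | no _ | no _ | yes refl = let (m , m≢k , m≢j) = fresh₂ 3≤n k j in six-cycle L L' m≢j m≢j m≢k
  ... | no k≢i | no k≢j | no i≢j = <-asym (ba-before L k≢i k≢j) (ab-before L' (k≢i ∘ sym) i≢j)

  link-end-injective : 3 ≤ n → ∀ {x y x' y'} → Link x y → Link x' y' → idx y ≡ idx y' → y ≡ y'
  link-end-injective _ {y = inj₁ _} {y' = inj₁ _} _ _ e = cong inj₁ e
  link-end-injective _ {y = inj₂ _} {y' = inj₂ _} _ _ e = cong inj₂ e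
  link-end-injective 3≤n {y = inj₁ _} {y' = inj₂ _} L L' refl = ⊥-elim (¬crossed-links 3≤n L L')
  link-end-injective 3≤n {y = inj₂ _} {y' = inj₁ _} L L' refl = ⊥-elim (¬crossed-links 3≤n L' L)

  ¬first-last-link-ends₁ : 4 ≤ n → ∀ {f l x y x' y'} → First f → Last (inj₁ l) →
                           Link x y → idx y ≡ idx f → Link x' y' → idx y' ≡ l → ⊥
  ¬first-last-link-ends₁ 4≤n {y' = inj₁ _} F Z L _ L' refl = end-not-last (<⇒≤ 4≤n) L' Z
  ¬first-last-link-ends₁ 4≤n {x' = inj₂ _} {y' = inj₂ _} F Z L _ L' refl = <⇒≱ (bb-before L') (Z _)
  ¬first-last-link-ends₁ 4≤n {f = inj₁ _} {y = inj₁ _} {x' = inj₁ _} {y' = inj₂ _} F Z L refl L' refl =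
    <⇒≱ (Link⇒< L) (F _)
  ¬first-last-link-ends₁ 4≤n {f = inj₂ _} {y = inj₂ _} {x' = inj₁ _} {y' = inj₂ _} F Z L refl L' refl =
    <⇒≱ (Link⇒< L) (F _)
  ¬first-last-link-ends₁ 4≤n {inj₁ m₀} {l} {y = inj₂ _} {x' = inj₁ k} {y' = inj₂ _}
    F Z L refl L' refl with m₀ ≟ᶠ k | m₀ ≟ᶠ l
  ... | yes refl | _ = start-not-first (<⇒≤ 4≤n) L' F
  ... | no _ | yes refl = case pos-injective (≤-antisym (F (inj₂ l)) (Z (inj₂ l))) of λ ()
  ... | no m₀≢k | no m₀≢l = <⇒≱ (ab-after L' m₀≢k m₀≢l) (F _)
  ¬first-last-link-ends₁ 4≤n {inj₂ _} {l} {inj₁ i} {inj₁ _} {x' = inj₁ k} {y' = inj₂ _}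
    F Z L refl L' refl with i ≟ᶠ k | i ≟ᶠ l
  ... | yes refl | _ = case Link-functional L L' of λ ()
  ... | no _ | yes refl = <⇒≱ (Link⇒< L) (Z _)
  ... | no i≢k | no i≢l = <-asym (ab-after L' i≢k i≢l)
    (<-trans (Link⇒< L) (<-trans (aa-after L) (<-trans (ab-before L' i≢k i≢l) (Link⇒< L'))))
  ¬first-last-link-ends₁ 4≤n {inj₂ m₀} {l} {inj₂ i} {inj₁ _} {x' = inj₁ k} {y' = inj₂ _}
    F Z L refl L' refl with l ≟ᶠ m₀ | l ≟ᶠ i
  ... | yes refl | _ = end-not-last (<⇒≤ 4≤n) L Z
  ... | no l≢m₀ | no l≢i = <⇒≱ (ba-before L l≢i l≢m₀) (Z _)
  ... | no l≢m₀ | yes refl =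
    let (m , m≢k , m≢l , m≢m₀) = fresh₃ 4≤n k l m₀ in
    <-asym (ab-after L' m≢k m≢l) (ba-before L m≢l m≢m₀)

crAdj-swap : ∀ {n} (u v : V n) → CrAdj n (swap u) (swap v) ≡ CrAdj n u v
crAdj-swap (inj₁ _) (inj₁ _) = refl
crAdj-swap (inj₁ _) (inj₂ _) = refl
crAdj-swap (inj₂ _) (inj₁ _) = refl
crAdj-swap (inj₂ _) (inj₂ _) = refl

idx-swap : ∀ {n} (u : V n) → idx (swap u) ≡ idx u
idx-swap (inj₁ _) = refl
idx-swap (inj₂ _) = refl

module _ {n : ℕ} (pos : V n → ℕ) (pos-injective : ∀ {u v} → pos u ≡ pos v → u ≡ v) where
  open Links pos pos-injective

  -- Swapping the two sides is an automorphism of the crown; it reduces z = b_l to z = a_l.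
  private
    swapped-injective : ∀ {u v} → pos (swap u) ≡ pos (swap v) → u ≡ v
    swapped-injective {u} {v} e =
      trans (sym (swap-involutive u)) (trans (cong swap (pos-injective e)) (swap-involutive v))

    module Swapped = Links (pos ∘ swap) swapped-injective

    unswap : ∀ {u v} → Link (swap u) (swap v) → Swapped.Link u v
    unswap {u} {v} L = record
      { next     = Link.next L
      ; forward  = λ r lt a → subst id (crAdj-swap v r)
          (Link.forward L (swap r) lt (subst id (sym (crAdj-swap u r)) a))
      ; backward = λ r lt a → subst id (crAdj-swap u r)
          (Link.backward L (swap r) lt (subst id (sym (crAdj-swap v r)) a))
      }

    Link-swap : ∀ {x y} → Link x y → Swapped.Link (swap x) (swap y)
    Link-swap {x} {y} L = unswap (subst₂ Link (sym (swap-involutive x)) (sym (swap-involutive y)) L)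

  ¬first-last-link-ends : 4 ≤ n → ∀ {f z x y x' y'} → First f → Last z →
                          Link x y → idx y ≡ idx f → Link x' y' → idx y' ≡ idx z → ⊥
  ¬first-last-link-ends 4≤n {z = inj₁ _} = ¬first-last-link-ends₁ 4≤n
  ¬first-last-link-ends 4≤n {f} {inj₂ _} {y = y} {y' = y'} F Z L e L' e' =
    Swapped.¬first-last-link-ends₁ 4≤n
      (λ w → subst (_≤ pos (swap w)) (sym (cong pos (swap-involutive f))) (F (swap w)))
      (λ w → Z (swap w))
      (Link-swap L) (trans (idx-swap y) (trans e (sym (idx-swap f))))
      (Link-swap L') (trans (idx-swap y') e')

-- Counting the classes of an ordering

predecessor : ∀ {M} {s t : Fin M} → toℕ s < toℕ t → ∃ λ (p : Fin M) → suc (toℕ p) ≡ toℕ t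
predecessor {t = suc p} _ = inject₁ p , cong suc (toℕ-inject₁ p)

bottom-top : ∀ {M} → 0 < M → ∃₂ λ (b t : Fin M) → toℕ b ≡ 0 × ∀ (i : Fin M) → toℕ i ≤ toℕ t
bottom-top {suc M} _ = zero , fromℕ M , refl , ≤fromℕ

extend-injective : ∀ {M} {A : Set} {f : Fin M → A} (a : A) →
                   Injective _≡_ _≡_ f → (∀ t → f t ≢ a) → Injective _≡_ _≡_ (a Vector.∷ f)
extend-injective {f = f} a f-inj a∉f {zero} {zero} _ = refl
extend-injective {f = f} a f-inj a∉f {zero} {suc t} e = ⊥-elim (a∉f t (sym e))
extend-injective {f = f} a f-inj a∉f {suc t} {zero} e = ⊥-elim (a∉f t e)
extend-injective {f = f} a f-inj a∉f {suc t} {suc t'} e = cong suc (f-inj e)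

injective⊎⇒≤ : ∀ {M n k} {f : Fin M → Fin n ⊎ Fin k} → Injective _≡_ _≡_ f → M ≤ n + k
injective⊎⇒≤ {n = n} {k} f-inj = injective⇒≤ λ e →
  f-inj (trans (sym (splitAt-join n k _)) (trans (cong (splitAt n) e) (splitAt-join n k _)))

module Positions (G : Graph) {k : ℕ} (c : Fin (N G) → Fin k) (π : Permutation′ (N G)) where

  vertexAt : Fin (N G) → Fin (N G)
  vertexAt t = π ⟨$⟩ˡ t

  classAt : Fin (N G) → Fin k
  classAt t = c (vertexAt t)

  toℕ-π-vertexAt : ∀ t → toℕ (π ⟨$⟩ʳ vertexAt t) ≡ toℕ t
  toℕ-π-vertexAt t = cong toℕ (inverseʳ π)

  LinkedAt : Fin (N G) → Set
  LinkedAt t = ∃ λ s → suc (toℕ s) ≡ toℕ t × classAt s ≡ classAt t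

  linkedAt? : ∀ t → Dec (LinkedAt t)
  linkedAt? t = any? λ s → (suc (toℕ s) ℕ.≟ toℕ t) ×-dec (classAt s ≟ᶠ classAt t)

  linked-after-class-member : ClassesConsecutive G c π → ∀ {t t'} →
                              toℕ t < toℕ t' → classAt t ≡ classAt t' → LinkedAt t'
  linked-after-class-member cc {t} {t'} t<t' same with predecessor t<t'
  ... | p , p+1≡t' with m<1+n⇒m<n∨m≡n (subst (toℕ t <_) (sym p+1≡t') t<t')
  ...   | inj₂ t≡p = p , p+1≡t' , subst (λ s → classAt s ≡ classAt t') (toℕ-injective t≡p) same
  ...   | inj₁ t<p = p , p+1≡t' , trans (cc _ _ _ (≺ t<p) (≺ (subst (toℕ p <_) p+1≡t' ≤-refl)) same) same
    where
    ≺ : ∀ {s s'} → toℕ s < toℕ s' → toℕ (π ⟨$⟩ʳ vertexAt s) < toℕ (π ⟨$⟩ʳ vertexAt s')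
    ≺ {s} {s'} = subst₂ _<_ (sym (toℕ-π-vertexAt s)) (sym (toℕ-π-vertexAt s'))

  unlinked-injective : ClassesConsecutive G c π → ∀ {t t'} →
                       ¬ LinkedAt t → ¬ LinkedAt t' → classAt t ≡ classAt t' → t ≡ t'
  unlinked-injective cc {t} {t'} ¬L ¬L' same with <-cmp (toℕ t) (toℕ t')
  ... | tri< t<t' _ _ = ⊥-elim (¬L' (linked-after-class-member cc t<t' same))
  ... | tri≈ _ t≡t' _ = toℕ-injective t≡t'
  ... | tri> _ _ t'<t = ⊥-elim (¬L (linked-after-class-member cc t'<t (sym same)))

module CrownOrdering {n k : ℕ} (c : Fin (n + n) → Fin k) (π : Permutation′ (n + n))
  (sc : StronglyConsistent (CR n) c π) (cc : ClassesConsecutive (CR n) c π) where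

  open Positions (CR n) c π

  pos : V n → ℕ
  pos v = toℕ (π ⟨$⟩ʳ join n n v)

  pos-injective : ∀ {u v} → pos u ≡ pos v → u ≡ v
  pos-injective {u} {v} e = trans (sym (splitAt-join n n u)) (trans (cong (splitAt n)
    (trans (sym (inverseˡ π)) (trans (cong (π ⟨$⟩ˡ_) (toℕ-injective e)) (inverseˡ π))))
    (splitAt-join n n v))

  open Links pos pos-injective

  pos-splitAt : ∀ p → pos (splitAt n p) ≡ toℕ (π ⟨$⟩ʳ p)
  pos-splitAt p = cong (λ q → toℕ (π ⟨$⟩ʳ q)) (join-splitAt n n p)

  adj-join : ∀ {u} r → CrAdj n u (splitAt n (join n n r)) ≡ CrAdj n u r
  adj-join {u} r = cong (CrAdj n u) (splitAt-join n n r)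

  consecutive⇒Link : ∀ {p q} → c p ≡ c q → toℕ (π ⟨$⟩ʳ q) ≡ suc (toℕ (π ⟨$⟩ʳ p)) →
                     Link (splitAt n p) (splitAt n q)
  consecutive⇒Link {p} {q} same next = record
    { next     = trans (pos-splitAt q) (trans next (cong suc (sym (pos-splitAt p))))
    ; forward  = λ r q<r a → subst id (adj-join r) (proj₁ sc p q (join n n r) p<q
        (subst (_< pos r) (pos-splitAt q) q<r) same (subst id (sym (adj-join r)) a))
    ; backward = λ r r<p a → subst id (adj-join r) (proj₂ sc q p (join n n r) p<q
        (subst (pos r <_) (pos-splitAt p) r<p) (sym same) (subst id (sym (adj-join r)) a))
    }
    where
    p<q : toℕ (π ⟨$⟩ʳ p) < toℕ (π ⟨$⟩ʳ q)
    p<q = subst (toℕ (π ⟨$⟩ʳ p) <_) (sym next) ≤-refl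

  crownAt : Fin (n + n) → V n
  crownAt t = splitAt n (vertexAt t)

  pos-crownAt : ∀ t → pos (crownAt t) ≡ toℕ t
  pos-crownAt t = trans (pos-splitAt (vertexAt t)) (toℕ-π-vertexAt t)

  crownAt-injective : Injective _≡_ _≡_ crownAt
  crownAt-injective {t} {t'} e =
    toℕ-injective (trans (sym (pos-crownAt t)) (trans (cong pos e) (pos-crownAt t')))

  LinkedAt⇒Link : ∀ {t} → (l : LinkedAt t) → Link (crownAt (proj₁ l)) (crownAt t)
  LinkedAt⇒Link {t} (s , s+1≡t , same) = consecutive⇒Link same
    (trans (toℕ-π-vertexAt t) (trans (sym s+1≡t) (cong suc (sym (toℕ-π-vertexAt s)))))

  label′ : ∀ t → Dec (LinkedAt t) → Fin n ⊎ Fin k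
  label′ t (yes _) = inj₁ (idx (crownAt t))
  label′ t (no _) = inj₂ (classAt t)

  label : Fin (n + n) → Fin n ⊎ Fin k
  label t = label′ t (linkedAt? t)

  label-injective : 3 ≤ n → Injective _≡_ _≡_ label
  label-injective 3≤n {t} {t'} = injective (linkedAt? t) (linkedAt? t')
    where
    injective : ∀ d d' → label′ t d ≡ label′ t' d' → t ≡ t'
    injective (yes l) (yes l') e =
      crownAt-injective (link-end-injective 3≤n (LinkedAt⇒Link l) (LinkedAt⇒Link l') (inj₁-injective e))
    injective (no ¬l) (no ¬l') e = unlinked-injective cc ¬l ¬l' (inj₂-injective e)
    injective (yes _) (no _) ()
    injective (no _) (yes _) ()

  linked-label : ∀ {t i} → label t ≡ inj₁ i → LinkedAt t × idx (crownAt t) ≡ i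
  linked-label {t} = linked (linkedAt? t)
    where
    linked : ∀ {i} d → label′ t d ≡ inj₁ i → LinkedAt t × idx (crownAt t) ≡ i
    linked (yes l) e = l , inj₁-injective e

  missing-link-index : 4 ≤ n → ∃ λ i → ∀ t → label t ≢ inj₁ i
  missing-link-index 4≤n
    with b , t , b≡0 , top ← bottom-top (≤-trans (s≤s z≤n) (≤-trans 4≤n (m≤m+n n n)))
    with any? (λ s → linkedAt? s ×-dec (idx (crownAt s) ≟ᶠ idx (crownAt b)))
  ... | no ¬f-linked = idx (crownAt b) , λ s e → ¬f-linked (s , linked-label e)
  ... | yes (s , ls , es) = idx (crownAt t) , λ s' e → let (ls' , es') = linked-label e in
    ¬first-last-link-ends pos pos-injective 4≤n {crownAt b} {crownAt t} first last
      (LinkedAt⇒Link ls) es (LinkedAt⇒Link ls') es'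
    where
    first : First (crownAt b)
    first w = subst (_≤ pos w) (sym (trans (pos-crownAt b) b≡0)) z≤n
    last : Last (crownAt t)
    last w = subst (pos w ≤_) (sym (pos-crownAt t)) (top _)

  n≤k : 3 ≤ n → n ≤ k
  n≤k 3≤n = +-cancelˡ-≤ n n k (injective⊎⇒≤ (label-injective 3≤n))

  n<k : 4 ≤ n → n < k
  n<k 4≤n with i , i-missing ← missing-link-index 4≤n =
    +-cancelˡ-≤ n (suc n) k (subst (_≤ n + k) (sym (+-suc n n))
      (injective⊎⇒≤ (extend-injective (inj₁ i) (label-injective (<⇒≤ 4≤n)) i-missing)))

-- An ordering of the crown with n + 1 classes

injective⇒surjective : ∀ {M} {f : Fin M → Fin M} → Injective _≡_ _≡_ f → ∀ y → ∃ λ x → f x ≡ y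
injective⇒surjective {suc M} {f} f-inj y with any? (λ x → f x ≟ᶠ y)
... | yes hit = hit
... | no miss = ⊥-elim (1+n≰n (injective⇒≤ {f = squeeze} squeeze-injective))
  where
  squeeze : Fin (suc M) → Fin M
  squeeze x = punchOut {i = y} {j = f x} (λ e → miss (x , sym e))
  squeeze-injective : Injective _≡_ _≡_ squeeze
  squeeze-injective {a} {b} e =
    f-inj (punchOut-injective (λ e → miss (a , sym e)) (λ e → miss (b , sym e)) e)

injective⇒permutation : ∀ {M} (f : Fin M → Fin M) → Injective _≡_ _≡_ f → Permutation′ M
injective⇒permutation f f-inj =
  permutation f (proj₁ ∘ surj) (proj₂ ∘ surj) (λ x → f-inj (proj₂ (surj (f x))))
  where surj = injective⇒surjective f-inj

even : ℕ → Bool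
even zero = true
even (suc i) = not (even i)

module Construction (m : ℕ) where

  n : ℕ
  n = suc m

  early : V n → Bool
  early (inj₁ i) = even (toℕ i)
  early (inj₂ i) = not (even (toℕ i))

  side : V n → Bool
  side (inj₁ _) = true
  side (inj₂ _) = false

  -- T_i is the vertex v of index i with early v. For b = true (b = false), band b i and
  -- slot b i are the class and the position of T_i (of F_i).
  band : Bool → ℕ → ℕ
  band true i = i
  band false i = suc i

  slot : Bool → ℕ → ℕ
  slot true zero = zero
  slot true (suc i) = suc (i + i)
  slot false i with i ℕ.≟ m
  ... | yes _ = suc (m + m)
  ... | no _ = suc (suc (i + i))

  classOf position : V n → ℕ
  classOf v = band (early v) (toℕ (idx v))
  position v = slot (early v) (toℕ (idx v))

  double-suc : ∀ i → suc i + suc i ≡ suc (suc (i + i))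
  double-suc i = cong suc (+-suc i i)

  slot-late : ∀ {i} → i ≢ m → slot false i ≡ suc (suc (i + i))
  slot-late {i} i≢m with i ℕ.≟ m
  ... | yes i≡m = ⊥-elim (i≢m i≡m)
  ... | no _ = refl

  slot≤band : ∀ b i → slot b i ≤ band b i + band b i
  slot≤band true zero = z≤n
  slot≤band true (suc i) = ≤-trans (n≤1+n _) (≤-reflexive (sym (double-suc i)))
  slot≤band false i with i ℕ.≟ m
  ... | yes refl = ≤-trans (n≤1+n _) (≤-reflexive (sym (double-suc m)))
  ... | no _ = ≤-reflexive (sym (double-suc i))

  band≤slot : ∀ b i → band b i + band b i ≤ suc (slot b i)
  band≤slot true zero = z≤n
  band≤slot true (suc i) = ≤-reflexive (double-suc i)
  band≤slot false i with i ℕ.≟ m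
  ... | yes refl = ≤-reflexive (double-suc m)
  ... | no _ = ≤-trans (≤-reflexive (double-suc i)) (n≤1+n _)

  slot-mono : ∀ {b i b' j} → band b i < band b' j → slot b i < slot b' j
  slot-mono {b} {i} {b'} {j} lt = s≤s⁻¹ (begin
    suc (suc (slot b i))      ≤⟨ s≤s (s≤s (slot≤band b i)) ⟩
    suc (suc (a + a))         ≡⟨ double-suc a ⟨
    suc a + suc a             ≤⟨ +-mono-≤ lt lt ⟩
    band b' j + band b' j     ≤⟨ band≤slot b' j ⟩
    suc (slot b' j)           ∎)
    where
    open ≤-Reasoning
    a = band b i

  slot<2n : ∀ b i → i ≤ m → slot b i < n + n
  slot<2n true i i≤m = s≤s (≤-trans (slot≤band true i)
    (≤-trans (+-mono-≤ i≤m i≤m) (≤-trans (n≤1+n _) (≤-reflexive (sym (+-suc m m))))))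
  slot<2n false i i≤m with i ℕ.≟ m
  ... | yes refl = ≤-reflexive (sym (double-suc m))
  ... | no i≢m = s≤s (≤-trans (≤-reflexive (sym (double-suc i)))
    (≤-trans (+-mono-≤ i<m i<m) (≤-trans (n≤1+n _) (≤-reflexive (sym (+-suc m m))))))
    where i<m = ≤∧≢⇒< i≤m i≢m

  class-mono : ∀ {u v} → classOf u < classOf v → position u < position v
  class-mono {u} {v} = slot-mono {early u} {toℕ (idx u)} {early v} {toℕ (idx v)}

  position<2n : ∀ v → position v < n + n
  position<2n v = slot<2n (early v) (toℕ (idx v)) (s≤s⁻¹ (toℕ<n (idx v)))

  vertex-ext : ∀ {u v} → early u ≡ early v → idx u ≡ idx v → u ≡ v
  vertex-ext {inj₁ _} {inj₁ _} _ refl = refl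
  vertex-ext {inj₂ _} {inj₂ _} _ refl = refl
  vertex-ext {inj₁ _} {inj₂ _} e refl = ⊥-elim (not-¬ refl e)
  vertex-ext {inj₂ _} {inj₁ _} e refl = ⊥-elim (not-¬ refl (sym e))

  record Pair (u v : V n) : Set where
    constructor pair
    field
      early-first : early u ≡ true
      late-second : early v ≡ false
      index-step  : toℕ (idx u) ≡ suc (toℕ (idx v))

  Pair⇒next : ∀ {u v} → Pair u v → position v ≡ suc (position u)
  Pair⇒next {u} {v} (pair eu ev iu) = begin
    slot (early v) j          ≡⟨ cong (λ b → slot b j) ev ⟩
    slot false j              ≡⟨ slot-late j≢m ⟩
    suc (slot true (suc j))   ≡⟨ cong suc (cong₂ slot eu iu) ⟨
    suc (position u)          ∎
    where
    open ≡-Reasoning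
    j = toℕ (idx v)
    j≢m : j ≢ m
    j≢m j≡m = <-irrefl (trans iu (cong suc j≡m)) (toℕ<n (idx u))

  same-class⇒Pair : ∀ {u v} → classOf u ≡ classOf v → u ≢ v → Pair u v ⊎ Pair v u
  same-class⇒Pair {u} {v} same u≢v with early u in eu | early v in ev
  ... | true  | true  = ⊥-elim (u≢v (vertex-ext (trans eu (sym ev)) (toℕ-injective same)))
  ... | false | false = ⊥-elim (u≢v (vertex-ext (trans eu (sym ev)) (toℕ-injective (suc-injective same))))
  ... | true  | false = inj₁ (pair eu ev same)
  ... | false | true  = inj₂ (pair ev eu (sym same))

  oriented-pair : ∀ {p q} → position p < position q → classOf p ≡ classOf q → Pair p q
  oriented-pair {p} {q} p<q same
    with same-class⇒Pair {p} {q} same (λ p≡q → <-irrefl (cong position p≡q) p<q)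
  ... | inj₁ p-q = p-q
  ... | inj₂ q-p = ⊥-elim (<-asym p<q (subst (position q <_) (sym (Pair⇒next q-p)) (n<1+n _)))

  position-injective : ∀ {u v} → position u ≡ position v → u ≡ v
  position-injective {u} {v} e with ≡-dec _≟ᶠ_ _≟ᶠ_ u v | <-cmp (classOf u) (classOf v)
  ... | yes u≡v | _ = u≡v
  ... | no _ | tri< lt _ _ = ⊥-elim (<⇒≢ (class-mono {u} {v} lt) e)
  ... | no _ | tri> _ _ gt = ⊥-elim (<⇒≢ (class-mono {v} {u} gt) (sym e))
  ... | no u≢v | tri≈ _ same _ with same-class⇒Pair {u} {v} same u≢v
  ...   | inj₁ u-v = ⊥-elim (<⇒≢ (n<1+n _) (trans e (Pair⇒next u-v)))
  ...   | inj₂ v-u = ⊥-elim (<⇒≢ (n<1+n _) (trans (sym e) (Pair⇒next v-u)))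

  crAdj⇒ : ∀ {u r} → CrAdj n u r → side u ≢ side r × idx u ≢ idx r
  crAdj⇒ {inj₁ _} {inj₂ _} a = (λ ()) , a
  crAdj⇒ {inj₂ _} {inj₁ _} a = (λ ()) , a

  ⇒crAdj : ∀ {u r} → side u ≢ side r → idx u ≢ idx r → CrAdj n u r
  ⇒crAdj {inj₁ _} {inj₂ _} _ i≢j = i≢j
  ⇒crAdj {inj₂ _} {inj₁ _} _ i≢j = i≢j
  ⇒crAdj {inj₁ _} {inj₁ _} s≢s _ = s≢s refl
  ⇒crAdj {inj₂ _} {inj₂ _} s≢s _ = s≢s refl

  Pair⇒same-side : ∀ {u v} → Pair u v → side u ≡ side v
  Pair⇒same-side {inj₁ _} {inj₁ _} _ = refl
  Pair⇒same-side {inj₂ _} {inj₂ _} _ = refl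
  Pair⇒same-side {inj₁ _} {inj₂ j} (pair eu ev iu) with () ← trans (sym eu) (trans (cong even iu) ev)
  Pair⇒same-side {inj₂ _} {inj₁ j} (pair eu ev iu) with () ←
    trans (sym eu) (trans (cong (not ∘ even) iu) (trans (not-involutive (even (toℕ j))) ev))

  twins-opposite : ∀ {u v} → idx u ≡ idx v → side u ≢ side v → early u ≡ not (early v)
  twins-opposite {inj₁ i} {inj₂ _} refl _ = sym (not-involutive (even (toℕ i)))
  twins-opposite {inj₂ _} {inj₁ _} refl _ = refl
  twins-opposite {inj₁ _} {inj₁ _} refl s≢s = ⊥-elim (s≢s refl)
  twins-opposite {inj₂ _} {inj₂ _} refl s≢s = ⊥-elim (s≢s refl)

  consistent-by-position : ∀ {p q r} → position p < position q → position q < position r →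
            classOf p ≡ classOf q → CrAdj n p r → CrAdj n q r
  consistent-by-position {p} {q} {r} p<q q<r same p~r = ⇒crAdj sides indices
    where
    p-q = oriented-pair p<q same
    sides : side q ≢ side r
    sides e = proj₁ (crAdj⇒ p~r) (trans (Pair⇒same-side p-q) e)
    indices : idx q ≢ idx r
    indices e = <-asym q<r (class-mono {r} {q} (subst₂ _<_
      (sym (cong₂ band r-early (cong toℕ (sym e))))
      (sym (cong (λ b → band b (toℕ (idx q))) (Pair.late-second p-q)))
      (n<1+n _)))
      where
      r-early : early r ≡ true
      r-early = trans (twins-opposite (sym e) (sides ∘ sym)) (cong not (Pair.late-second p-q))

  revConsistent-by-position : ∀ {p q r} → position q < position p → position r < position q →
             classOf p ≡ classOf q → CrAdj n p r → CrAdj n q r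
  revConsistent-by-position {p} {q} {r} q<p r<q same p~r = ⇒crAdj sides indices
    where
    q-p = oriented-pair q<p (sym same)
    sides : side q ≢ side r
    sides e = proj₁ (crAdj⇒ p~r) (trans (sym (Pair⇒same-side q-p)) e)
    indices : idx q ≢ idx r
    indices e = <-asym r<q (class-mono {q} {r} (subst₂ _<_
      (sym (cong (λ b → band b (toℕ (idx q))) (Pair.early-first q-p)))
      (sym (cong₂ band r-late (cong toℕ (sym e))))
      (n<1+n _)))
      where
      r-late : early r ≡ false
      r-late = trans (twins-opposite (sym e) (sides ∘ sym)) (cong not (Pair.early-first q-p))

  consecutive-by-position : ∀ {p q r} → position p < position q → position q < position r →
                            classOf p ≢ classOf r
  consecutive-by-position {p} {q} {r} p<q q<r same = <⇒≱ p<q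
    (s≤s⁻¹ (subst (position q <_) (Pair⇒next (oriented-pair {p} {r} (<-trans p<q q<r) same)) q<r))

  bandFin : Bool → Fin n → Fin (suc n)
  bandFin true i = inject₁ i
  bandFin false i = suc i

  toℕ-bandFin : ∀ b i → toℕ (bandFin b i) ≡ band b (toℕ i)
  toℕ-bandFin true i = toℕ-inject₁ i
  toℕ-bandFin false i = refl

  class : Fin (n + n) → Fin (suc n)
  class t = bandFin (early (splitAt n t)) (idx (splitAt n t))

  place : Fin (n + n) → Fin (n + n)
  place t = fromℕ< (position<2n (splitAt n t))

  toℕ-place : ∀ t → toℕ (place t) ≡ position (splitAt n t)
  toℕ-place t = toℕ-fromℕ< (position<2n (splitAt n t))

  place-injective : Injective _≡_ _≡_ place
  place-injective {t} {t'} e = trans (sym (join-splitAt n n t)) (trans (cong (join n n)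
    (position-injective {splitAt n t} {splitAt n t'}
      (trans (sym (toℕ-place t)) (trans (cong toℕ e) (toℕ-place t')))))
    (join-splitAt n n t'))

  order : Permutation′ (n + n)
  order = injective⇒permutation place place-injective

  ≺⇒< : ∀ {p q} → _≺[_]_ (CR n) p order q → position (splitAt n p) < position (splitAt n q)
  ≺⇒< {p} {q} = subst₂ _<_ (toℕ-place p) (toℕ-place q)

  class≡⇒classOf≡ : ∀ {p q} → class p ≡ class q → classOf (splitAt n p) ≡ classOf (splitAt n q)
  class≡⇒classOf≡ {p} {q} e =
    trans (sym (toℕ-bandFin (early u) (idx u))) (trans (cong toℕ e) (toℕ-bandFin (early v) (idx v)))
    where
    u = splitAt n p
    v = splitAt n q

  late : Fin n → V n
  late i = if even (toℕ i) then inj₂ i else inj₁ i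

  early-late : ∀ i → early (late i) ≡ false
  early-late i with even (toℕ i) in e
  ... | true = cong not e
  ... | false = e

  class-onto : ∀ y → ∃ λ t → class t ≡ y
  class-onto zero =
    join n n (inj₁ zero) , cong (λ v → bandFin (early v) (idx v)) (splitAt-join n n (inj₁ zero))
  class-onto (suc i) = join n n (late i) , trans
    (cong (λ v → bandFin (early v) (idx v)) (splitAt-join n n (late i)))
    (cong₂ bandFin (early-late i) (idx-late i))
    where
    idx-late : ∀ i → idx (late i) ≡ i
    idx-late i with even (toℕ i)
    ... | true = refl
    ... | false = refl

  precThin : PrecThin (CR n) (suc n)
  precThin = class , strictlySurjective⇒surjective class-onto , order ,
    ( (λ p q r p≺q q≺r same → consistent-by-position {S p} {S q} {S r}
          (≺⇒< {p} {q} p≺q) (≺⇒< {q} {r} q≺r) (class≡⇒classOf≡ {p} {q} same))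
    , (λ p q r q≺p r≺q same → revConsistent-by-position {S p} {S q} {S r}
          (≺⇒< {q} {p} q≺p) (≺⇒< {r} {q} r≺q) (class≡⇒classOf≡ {p} {q} same)) )
    , λ p q r p≺q q≺r same → ⊥-elim (consecutive-by-position {S p} {S q} {S r}
          (≺⇒< {p} {q} p≺q) (≺⇒< {q} {r} q≺r) (class≡⇒classOf≡ {p} {r} same))
    where S = splitAt n

-- Small crowns

module Certify (G : Graph) (adj? : ∀ u v → Dec (Adj G u v))
  {k : ℕ} (c : Fin (N G) → Fin k) (π : Permutation′ (N G)) where

  private
    _≺?_ : ∀ u v → Dec (_≺[_]_ G u π v)
    u ≺? v = (π ⟨$⟩ʳ u) <? (π ⟨$⟩ʳ v)

  onto? : Dec (∀ y → ∃ λ t → c t ≡ y)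
  onto? = all? λ y → any? λ t → c t ≟ᶠ y

  consistent? : Dec (Consistent G c π)
  consistent? = all? λ p → all? λ q → all? λ r →
    (p ≺? q) →-dec ((q ≺? r) →-dec ((c p ≟ᶠ c q) →-dec (adj? p r →-dec adj? q r)))

  revConsistent? : Dec (RevConsistent G c π)
  revConsistent? = all? λ p → all? λ q → all? λ r →
    (q ≺? p) →-dec ((r ≺? q) →-dec ((c p ≟ᶠ c q) →-dec (adj? p r →-dec adj? q r)))

  consecutive? : Dec (ClassesConsecutive G c π)
  consecutive? = all? λ p → all? λ q → all? λ r →
    (p ≺? q) →-dec ((q ≺? r) →-dec ((c p ≟ᶠ c r) →-dec (c q ≟ᶠ c p)))

  certify : True onto? → True consistent? → True revConsistent? → True consecutive? → PrecThin G k
  certify onto cons rev consec = c , strictlySurjective⇒surjective (toWitness onto) , π ,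
    (toWitness cons , toWitness rev) , toWitness consec

crAdj? : ∀ n u v → Dec (Adj (CR n) u v)
crAdj? n u v = decide (splitAt n u) (splitAt n v)
  where
  decide : ∀ x y → Dec (CrAdj n x y)
  decide (inj₁ i) (inj₂ j) = ¬? (i ≟ᶠ j)
  decide (inj₂ i) (inj₁ j) = ¬? (i ≟ᶠ j)
  decide (inj₁ _) (inj₁ _) = no λ ()
  decide (inj₂ _) (inj₂ _) = no λ ()

pthin[CR1]≤1 : PrecThin (CR 1) 1
pthin[CR1]≤1 = Certify.certify (CR 1) (crAdj? 1) (λ _ → 0F) Permutation.id _ _ _ _

-- the order a₀ b₁ b₀ a₁, in which every edge joins consecutive vertices
pthin[CR2]≤1 : PrecThin (CR 2) 1
pthin[CR2]≤1 = Certify.certify (CR 2) (crAdj? 2) (λ _ → 0F) (transpose 1F 3F) _ _ _ _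

-- the order a₀ b₁ a₂ b₀ a₁ b₂ with classes {a₀}, {b₁, a₂, b₀, a₁}, {b₂}
classes₃ : Fin 6 → Fin 3
classes₃ 0F = 0F
classes₃ 5F = 2F
classes₃ _  = 1F

pthin[CR3]≤3 : PrecThin (CR 3) 3
pthin[CR3]≤3 = Certify.certify (CR 3) (crAdj? 3) classes₃ (transpose 1F 4F)
  _ _ _ _

1≤classes : ∀ {n k} → PrecThin (CR (suc n)) k → 1 ≤ k
1≤classes {k = suc _} _ = s≤s z≤n
1≤classes {k = zero} (c , _) with () ← c zero

n≤pthin : ∀ {n k} → 3 ≤ n → PrecThin (CR n) k → n ≤ k
n≤pthin 3≤n (c , _ , π , sc , cc) = CrownOrdering.n≤k c π sc cc 3≤n

n<pthin : ∀ {n k} → 4 ≤ n → PrecThin (CR n) k → n < k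
n<pthin 4≤n (c , _ , π , sc , cc) = CrownOrdering.n<k c π sc cc 4≤n

pthin[CR]≡n+1 : ∀ n → 4 ≤ n → PthinPrecIs (CR n) (n + 1)
pthin[CR]≡n+1 n@(suc m) 4≤n rewrite +-comm n 1 = Construction.precThin m , λ _ → n<pthin 4≤n

theorem20 : ((n : ℕ) → 4 ≤ n → PthinPrecIs (CR n) (n + 1))
    × PthinPrecIs (CR 1) 1 × PthinPrecIs (CR 2) 1 × PthinPrecIs (CR 3) 3
theorem20 = pthin[CR]≡n+1
  , (pthin[CR1]≤1 , λ _ → 1≤classes)
  , (pthin[CR2]≤1 , λ _ → 1≤classes)
  , (pthin[CR3]≤3 , λ _ → n≤pthin (s≤s (s≤s (s≤s z≤n))))
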